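{- Fix $n\ge 1$ and let $F_{1111}(n)$ be the number of zero-one matrices (of any size) with exactly $n$ ones and no zero row or zero column. Define a probability distribution on pairs of nonnegative integers by \[ \rho_{k,l}=\frac{1}{F_{1111}(n)}\binom{kl}{n}2^{ -k-l-2}. \] Consider the following random procedure: (i) draw integers $K,L$ with joint distribution $\rho_{k,l}$; (ii) choose a zero-one matrix with $K$ rows, $L$ columns and exactly $n$ ones (and $KL-n$ zeros) uniformly at random; (iii) delete all rows and all columns all of whose entries are $0$. Then the output is uniformly distributed over the set of zero-one matrices with exactly $n$ ones and no zero row or column, i.e. each such matrix is produced with probability $1/F_{1111}(n)$.
   Context: Matrices are counted as arrays: the order of rows and columns matters and repeated rows or columns are allowed. The fact that $\rho_{k,l}$ sums to $1$ is part of the setting (it follows from the identity $F_{1111}(n)=\sum_{k,l\ge0}2^{ -k-l-2}\binom{kl}{n}$). -}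

module Defs where

open import Data.Bool using (Bool; true; false; _∧_; _∨_)
open import Data.Nat using (ℕ; zero; suc; _+_; _*_; _≡ᵇ_)
open import Data.Nat.Combinatorics using (_C_)
open import Data.Integer using (+_)
open import Data.List as L using (List; []; _∷_; length; filterᵇ; concatMap; upTo)
open import Data.Vec as V using (Vec; []; _∷_)
import Data.List.Properties as LP
import Data.Bool.Properties as BP
open import Relation.Nullary.Decidable using (⌊_⌋)
open import Data.Rational as Q using (ℚ; 0ℚ; 1ℚ; ½; _/_)

-- A p × q zero-one matrix: a vector of p rows, each a vector of q booleans
-- (true = 1, false = 0).
Mat : ℕ → ℕ → Set
Mat p q = Vec (Vec Bool q) p

rowOnes : ∀ {q} → Vec Bool q → ℕ
rowOnes [] = 0
rowOnes (true ∷ r) = suc (rowOnes r)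
rowOnes (false ∷ r) = rowOnes r

numOnes : ∀ {p q} → Mat p q → ℕ
numOnes [] = 0
numOnes (r ∷ rs) = rowOnes r + numOnes rs

anyᵇ : ∀ {q} → Vec Bool q → Bool
anyᵇ [] = false
anyᵇ (b ∷ r) = b ∨ anyᵇ r

colMask : ∀ {p q} → Mat p q → Vec Bool q
colMask [] = V.replicate _ false
colMask (r ∷ rs) = V.zipWith _∨_ r (colMask rs)

allᵇ : ∀ {q} → Vec Bool q → Bool
allᵇ [] = true
allᵇ (b ∷ r) = b ∧ allᵇ r

noZeroRowᵇ : ∀ {p q} → Mat p q → Bool
noZeroRowᵇ [] = true
noZeroRowᵇ (r ∷ rs) = anyᵇ r ∧ noZeroRowᵇ rs

noZeroColᵇ : ∀ {p q} → Mat p q → Bool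
noZeroColᵇ M = allᵇ (colMask M)

select : ∀ {q} → Vec Bool q → Vec Bool q → List Bool
select [] [] = []
select (true ∷ m) (b ∷ r) = b ∷ select m r
select (false ∷ m) (b ∷ r) = select m r

toLL : ∀ {p q} → Mat p q → List (List Bool)
toLL M = L.map V.toList (V.toList M)

-- step (iii): delete all zero rows and all zero columns
-- (result given as a list of rows)
reduce : ∀ {p q} → Mat p q → List (List Bool)
reduce M = L.map (select (colMask M)) (filterᵇ anyᵇ (V.toList M))

eqLLᵇ : List (List Bool) → List (List Bool) → Bool
eqLLᵇ x y = ⌊ LP.≡-dec (LP.≡-dec BP._≟_) x y ⌋

vecsOver : ∀ {A : Set} → List A → (k : ℕ) → List (Vec A k)
vecsOver xs zero = [] ∷ []
vecsOver xs (suc k) = concatMap (λ x → L.map (x ∷_) (vecsOver xs k)) xs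

allMats : (k l : ℕ) → List (Mat k l)
allMats k l = vecsOver (vecsOver (true ∷ false ∷ []) l) k

admissibleᵇ : ℕ → ∀ {p q} → Mat p q → Bool
admissibleᵇ n M = (numOnes M ≡ᵇ n) ∧ (noZeroRowᵇ M ∧ noZeroColᵇ M)

sumℕ : List ℕ → ℕ
sumℕ = L.foldr _+_ 0

-- Such a p × q matrix has p ≤ n and q ≤ n (each row
-- and each column contains at least one of the n ones), so only sizes
-- p, q ≤ n are enumerated.
F1111 : ℕ → ℕ
F1111 n = sumℕ (L.map (λ p → sumℕ (L.map (λ q →
            length (filterᵇ (admissibleᵇ n) (allMats p q))) (upTo (suc n)))) (upTo (suc n)))

ℕtoℚ : ℕ → ℚ
ℕtoℚ m = (+ m) / 1

-- 1/m, with the convention 1/0 = 0 (never used with m = 0 below when it matters)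
invℕ : ℕ → ℚ
invℕ zero = 0ℚ
invℕ (suc m) = (+ 1) / suc m

pow½ : ℕ → ℚ
pow½ zero = 1ℚ
pow½ (suc m) = ½ Q.* pow½ m

sumℚ : List ℚ → ℚ
sumℚ = L.foldr Q._+_ 0ℚ

ρ : ℕ → ℕ → ℕ → ℚ
ρ n k l = (ℕtoℚ ((k * l) C n) Q.* pow½ (k + l + 2)) Q.* invℕ (F1111 n)

hits : (n k l : ℕ) → ∀ {p q} → Mat p q → ℕ
hits n k l M = length (filterᵇ (λ A → (numOnes A ≡ᵇ n) ∧ eqLLᵇ (reduce A) (toLL M)) (allMats k l))

-- probability that the procedure with (K,L) = (k,l) outputs M:
-- ρ_{k,l} · hits / binom(kl, n)   (uniform choice among the binom(kl,n) matrices;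
-- when binom(kl,n) = 0 we have ρ_{k,l} = 0 and the term is 0)
term : (n k l : ℕ) → ∀ {p q} → Mat p q → ℚ
term n k l M = (ρ n k l Q.* ℕtoℚ (hits n k l M)) Q.* invℕ ((k * l) C n)

partialProb : (n K L : ℕ) → ∀ {p q} → Mat p q → ℚ
partialProb n K L M = sumℚ (L.map (λ k → sumℚ (L.map (λ l → term n k l M) (upTo L))) (upTo K))

ProbIs : (n : ℕ) → ∀ {p q} → Mat p q → ℚ → Set
ProbIs n M s = ∀ (ε : ℚ) → 0ℚ Q.< ε →
  Σ ℕ λ N → ∀ K L → N Data.Nat.≤ K → N Data.Nat.≤ L → Q.∣ partialProb n K L M Q.- s ∣ Q.< ε
  where open import Data.Product using (Σ)
        import Data.Nat

{-# OPTIONS --safe #-}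

-- A k × l matrix A with n ones reduces to M (p × q, no zero row or column)
-- exactly when, for its column mask c, every row of A is either zero or is sent
-- by select c onto the next row of M.  This forces |c| = q, and the nonzero rows
-- may occupy any p of the k positions; so C(k,p)·C(l,q) matrices reduce to M and
-- the (k,l) term of the series is
--   C(k,p) 2^-(k+1) · C(l,q) 2^-(l+1) / F₁₁₁₁(n).
-- Each factor is a negative binomial distribution whose partial sum over k < K
-- is 1 − T_p(K)/2^K, where T_p(K) counts the outcomes of K fair coin tosses with
-- at most p heads.  T_p(K) is polynomial in K, so the rectangular partial sums
-- converge to 1/F₁₁₁₁(n).

module Submission where

open import Defs
open import Data.Bool using (Bool; true; false; _∧_; _∨_; not)
import Data.Bool.Properties as Boolₚ
open import Data.Bool.ListAction using (and; or)
open import Data.Empty using (⊥-elim)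
import Data.Integer as ℤ
import Data.Integer.Properties as ℤₚ
open import Data.List as List using (List; []; _∷_; _++_; map; length; filterᵇ; concatMap; upTo)
import Data.List.Properties as Listₚ
open import Data.Nat using (ℕ; zero; suc; _+_; _*_; _^_; _∸_; _≡ᵇ_; _≤_; _<_; z≤n; s≤s)
import Data.Nat.Properties as ℕₚ
open import Data.Nat.Combinatorics using (_C_; nCk+nC[k+1]≡[n+1]C[k+1]; nCk≡nC[n∸k]; nCn≡1; k>n⇒nCk≡0)
import Data.Nat.Coprimality as Coprimality
open import Data.Nat.ListAction using (sum; product)
import Data.Nat.ListAction.Properties as ListActionₚ
import Data.Nat.Solver as ℕ-Solver
open import Data.Product using (_×_; _,_; proj₁; proj₂; ∃-syntax)
open import Data.Rational as ℚ using (ℚ; mkℚ; 0ℚ; 1ℚ; ½)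
import Data.Rational.Properties as ℚₚ
import Data.Rational.Solver as ℚ-Solver
open import Data.Vec as Vec using (Vec; []; _∷_)
import Data.Vec.Properties as Vecₚ
open import Function using (_∘_; id; mk⇔; Equivalence)
open import Relation.Binary.Definitions using (DecidableEquality)
open import Relation.Binary.PropositionalEquality
open import Relation.Nullary using (Dec; does; yes; no)
open import Relation.Nullary.Decidable using (isYes≗does; dec-true)

open import Algebra.Properties.CommutativeSemigroup ℕₚ.+-commutativeSemigroup using (interchange)

private
  variable
    A B : Set
    k l : ℕ

-- Finite sums and counting

⟦_⟧ : Bool → ℕ
⟦ true ⟧  = 1
⟦ false ⟧ = 0

⟦∧⟧ : ∀ a b → ⟦ a ∧ b ⟧ ≡ ⟦ a ⟧ * ⟦ b ⟧
⟦∧⟧ true  b = sym (ℕₚ.+-identityʳ ⟦ b ⟧)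
⟦∧⟧ false b = refl

sumOver : List A → (A → ℕ) → ℕ
sumOver xs f = sum (map f xs)

syntax sumOver xs (λ x → e) = ∑[ x ∈ xs ] e

count : (A → Bool) → List A → ℕ
count P xs = ∑[ x ∈ xs ] ⟦ P x ⟧

length-filterᵇ : (P : A → Bool) (xs : List A) → length (filterᵇ P xs) ≡ count P xs
length-filterᵇ P [] = refl
length-filterᵇ P (x ∷ xs) with P x
... | true  = cong suc (length-filterᵇ P xs)
... | false = length-filterᵇ P xs

∑-cong : {f g : A → ℕ} → (∀ x → f x ≡ g x) → (xs : List A) → sumOver xs f ≡ sumOver xs g
∑-cong f≗g xs = cong sum (Listₚ.map-cong f≗g xs)

∑-zero : (xs : List A) → ∑[ x ∈ xs ] 0 ≡ 0
∑-zero []       = refl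
∑-zero (_ ∷ xs) = ∑-zero xs

count-false : (P : A → Bool) → (∀ x → P x ≡ false) → (xs : List A) → count P xs ≡ 0
count-false P never xs = trans (∑-cong (cong ⟦_⟧ ∘ never) xs) (∑-zero xs)

count-∧-false : (P : A → Bool) (xs : List A) → count (λ x → P x ∧ false) xs ≡ 0
count-∧-false P = count-false _ (Boolₚ.∧-zeroʳ ∘ P)

∑-+ : (f g : A → ℕ) (xs : List A) → ∑[ x ∈ xs ] (f x + g x) ≡ sumOver xs f + sumOver xs g
∑-+ f g []       = refl
∑-+ f g (x ∷ xs) = begin
  f x + g x + (∑[ y ∈ xs ] (f y + g y))  ≡⟨ cong (f x + g x +_) (∑-+ f g xs) ⟩
  f x + g x + (sumOver xs f + sumOver xs g) ≡⟨ interchange (f x) (g x) _ _ ⟩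
  (f x + sumOver xs f) + (g x + sumOver xs g) ∎
  where open ≡-Reasoning

∑-*ˡ : ∀ m (f : A → ℕ) (xs : List A) → ∑[ x ∈ xs ] (m * f x) ≡ m * sumOver xs f
∑-*ˡ m f []       = sym (ℕₚ.*-zeroʳ m)
∑-*ˡ m f (x ∷ xs) = trans (cong (m * f x +_) (∑-*ˡ m f xs)) (sym (ℕₚ.*-distribˡ-+ m (f x) _))

∑-*ʳ : ∀ m (f : A → ℕ) (xs : List A) → ∑[ x ∈ xs ] (f x * m) ≡ sumOver xs f * m
∑-*ʳ m f xs = begin
  ∑[ x ∈ xs ] (f x * m) ≡⟨ ∑-cong (λ x → ℕₚ.*-comm (f x) m) xs ⟩
  ∑[ x ∈ xs ] (m * f x) ≡⟨ ∑-*ˡ m f xs ⟩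
  m * sumOver xs f      ≡⟨ ℕₚ.*-comm m _ ⟩
  sumOver xs f * m      ∎
  where open ≡-Reasoning

∑-++ : (f : A → ℕ) (xs ys : List A) → sumOver (xs ++ ys) f ≡ sumOver xs f + sumOver ys f
∑-++ f xs ys = trans (cong sum (Listₚ.map-++ f xs ys)) (ListActionₚ.sum-++ (map f xs) (map f ys))

∑-map : (f : B → ℕ) (g : A → B) (xs : List A) → sumOver (map g xs) f ≡ ∑[ x ∈ xs ] f (g x)
∑-map f g xs = cong sum (sym (Listₚ.map-∘ xs))

∑-concatMap : (f : B → ℕ) (g : A → List B) (xs : List A) →
  sumOver (concatMap g xs) f ≡ ∑[ x ∈ xs ] sumOver (g x) f
∑-concatMap f g []       = refl
∑-concatMap f g (x ∷ xs) =
  trans (∑-++ f (g x) (concatMap g xs)) (cong (sumOver (g x) f +_) (∑-concatMap f g xs))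

∑-comm : (f : A → B → ℕ) (xs : List A) (ys : List B) →
  ∑[ x ∈ xs ] ∑[ y ∈ ys ] f x y ≡ ∑[ y ∈ ys ] ∑[ x ∈ xs ] f x y
∑-comm f []       ys = sym (∑-zero ys)
∑-comm f (x ∷ xs) ys =
  trans (cong (sumOver ys (f x) +_) (∑-comm f xs ys)) (sym (∑-+ (f x) _ ys))

∑-vecsOver : (xs : List A) (k : ℕ) (f : Vec A (suc k) → ℕ) →
  sumOver (vecsOver xs (suc k)) f ≡ ∑[ x ∈ xs ] ∑[ v ∈ vecsOver xs k ] f (x ∷ v)
∑-vecsOver xs k f = trans (∑-concatMap f _ xs) (∑-cong (λ x → ∑-map f (x ∷_) (vecsOver xs k)) xs)

∑-∑-separable : (f : A → ℕ) (g : B → ℕ) (xs : List A) (ys : List B) →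
  ∑[ x ∈ xs ] ∑[ y ∈ ys ] (f x * g y) ≡ sumOver xs f * sumOver ys g
∑-∑-separable f g xs ys = trans (∑-cong (λ x → ∑-*ˡ (f x) g ys) xs) (∑-*ʳ (sumOver ys g) f xs)

∑-∑-separable-+ : (f f′ : A → ℕ) (g g′ : B → ℕ) (xs : List A) (ys : List B) →
  ∑[ x ∈ xs ] ∑[ y ∈ ys ] (f x * g y + f′ x * g′ y) ≡
  sumOver xs f * sumOver ys g + sumOver xs f′ * sumOver ys g′
∑-∑-separable-+ f f′ g g′ xs ys = begin
  ∑[ x ∈ xs ] ∑[ y ∈ ys ] (f x * g y + f′ x * g′ y)
    ≡⟨ ∑-cong (λ x → ∑-+ (λ y → f x * g y) (λ y → f′ x * g′ y) ys) xs ⟩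
  ∑[ x ∈ xs ] (∑[ y ∈ ys ] (f x * g y) + ∑[ y ∈ ys ] (f′ x * g′ y))
    ≡⟨ ∑-+ (λ x → ∑[ y ∈ ys ] (f x * g y)) (λ x → ∑[ y ∈ ys ] (f′ x * g′ y)) xs ⟩
  ∑[ x ∈ xs ] ∑[ y ∈ ys ] (f x * g y) + ∑[ x ∈ xs ] ∑[ y ∈ ys ] (f′ x * g′ y)
    ≡⟨ cong₂ _+_ (∑-∑-separable f g xs ys) (∑-∑-separable f′ g′ xs ys) ⟩
  sumOver xs f * sumOver ys g + sumOver xs f′ * sumOver ys g′ ∎
  where open ≡-Reasoning

count-partition : (P : A → Bool) (key : A → B → Bool) (ks : List B) →
  (∀ x → count (key x) ks ≡ 1) →
  (xs : List A) → count P xs ≡ ∑[ c ∈ ks ] count (λ x → P x ∧ key x c) xs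
count-partition P key ks unique xs = begin
  ∑[ x ∈ xs ] ⟦ P x ⟧
    ≡⟨ ∑-cong (λ x → sym (trans (cong (⟦ P x ⟧ *_) (unique x)) (ℕₚ.*-identityʳ _))) xs ⟩
  ∑[ x ∈ xs ] (⟦ P x ⟧ * count (key x) ks)
    ≡⟨ ∑-cong (λ x → sym (∑-*ˡ ⟦ P x ⟧ (λ c → ⟦ key x c ⟧) ks)) xs ⟩
  ∑[ x ∈ xs ] ∑[ c ∈ ks ] (⟦ P x ⟧ * ⟦ key x c ⟧)
    ≡⟨ ∑-cong (λ x → ∑-cong (λ c → sym (⟦∧⟧ (P x) (key x c))) ks) xs ⟩
  ∑[ x ∈ xs ] ∑[ c ∈ ks ] ⟦ P x ∧ key x c ⟧
    ≡⟨ ∑-comm (λ x c → ⟦ P x ∧ key x c ⟧) xs ks ⟩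
  ∑[ c ∈ ks ] ∑[ x ∈ xs ] ⟦ P x ∧ key x c ⟧ ∎
  where open ≡-Reasoning

does-sound : {P : Set} (d : Dec P) → does d ≡ true → P
does-sound (yes p) _ = p

∧≡true⇒ : ∀ {a b} → a ∧ b ≡ true → a ≡ true × b ≡ true
∧≡true⇒ {true} b≡true = refl , b≡true

∧-interchange : ∀ a b c d → (a ∧ b) ∧ (c ∧ d) ≡ (a ∧ c) ∧ (b ∧ d)
∧-interchange true  b true  d = refl
∧-interchange true  b false d = Boolₚ.∧-zeroʳ b
∧-interchange false b c     d = refl

count-≟-vecsOver : (_≟_ : DecidableEquality A) (xs : List A) →
  (∀ a → count (λ x → does (a ≟ x)) xs ≡ 1) →
  (v : Vec A k) → count (λ w → does (Vecₚ.≡-dec _≟_ v w)) (vecsOver xs k) ≡ 1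
count-≟-vecsOver _≟_ xs unique []                  = refl
count-≟-vecsOver {A = A} {k = suc k} _≟_ xs unique (a ∷ v) = begin
  count (λ w → does ((a ∷ v) ≟ᵥ w)) (vecsOver xs (suc k))
    ≡⟨ ∑-vecsOver xs k _ ⟩
  ∑[ x ∈ xs ] ∑[ w ∈ vecsOver xs k ] ⟦ does ((a ∷ v) ≟ᵥ (x ∷ w)) ⟧
    ≡⟨ ∑-cong (λ x → ∑-cong (λ w → ⟦∧⟧ (does (a ≟ x)) (does (v ≟ᵥ w))) (vecsOver xs k)) xs ⟩
  ∑[ x ∈ xs ] ∑[ w ∈ vecsOver xs k ] (⟦ does (a ≟ x) ⟧ * ⟦ does (v ≟ᵥ w) ⟧)
    ≡⟨ ∑-∑-separable _ _ xs (vecsOver xs k) ⟩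
  count (λ x → does (a ≟ x)) xs * count (λ w → does (v ≟ᵥ w)) (vecsOver xs k)
    ≡⟨ cong₂ _*_ (unique a) (count-≟-vecsOver _≟_ xs unique v) ⟩
  1 ∎
  where
  open ≡-Reasoning
  _≟ᵥ_ : ∀ {n} → DecidableEquality (Vec A n)
  _≟ᵥ_ = Vecₚ.≡-dec _≟_

bitVecs : (l : ℕ) → List (Vec Bool l)
bitVecs = vecsOver (true ∷ false ∷ [])

_≟ᵛ_ : DecidableEquality (Vec Bool l)
_≟ᵛ_ = Vecₚ.≡-dec Boolₚ._≟_

_≟ᴸ_ : DecidableEquality (List Bool)
_≟ᴸ_ = Listₚ.≡-dec Boolₚ._≟_

_≟ᴸᴸ_ : DecidableEquality (List (List Bool))
_≟ᴸᴸ_ = Listₚ.≡-dec _≟ᴸ_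

eqLLᵇ≡does : (xs ys : List (List Bool)) → eqLLᵇ xs ys ≡ does (xs ≟ᴸᴸ ys)
eqLLᵇ≡does xs ys = isYes≗does (xs ≟ᴸᴸ ys)

count-≟-bitVecs : (v : Vec Bool l) → count (λ w → does (v ≟ᵛ w)) (bitVecs l) ≡ 1
count-≟-bitVecs = count-≟-vecsOver Boolₚ._≟_ (true ∷ false ∷ []) unique
  where
  unique : ∀ b → count (λ x → does (b Boolₚ.≟ x)) (true ∷ false ∷ []) ≡ 1
  unique true  = refl
  unique false = refl

∑-bitVecs-suc : (f : Vec Bool (suc l) → ℕ) →
  sumOver (bitVecs (suc l)) f ≡ ∑[ r ∈ bitVecs l ] f (true ∷ r) + ∑[ r ∈ bitVecs l ] f (false ∷ r)
∑-bitVecs-suc {l} f = trans (∑-vecsOver (true ∷ false ∷ []) l f)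
  (cong (sumOver (bitVecs l) (λ r → f (true ∷ r)) +_) (ℕₚ.+-identityʳ _))

-- Binomial coefficients

C-zeroʳ : ∀ n → n C 0 ≡ 1
C-zeroʳ n = trans (nCk≡nC[n∸k] {0} {n} z≤n) (nCn≡1 n)

C-pascal : ∀ n k → suc n C suc k ≡ n C k + n C suc k
C-pascal n k = sym (nCk+nC[k+1]≡[n+1]C[k+1] n k)

C-pos : ∀ {n k} → k ≤ n → 0 < n C k
C-pos {n}     {zero}  _         = subst (0 <_) (sym (C-zeroʳ n)) (s≤s z≤n)
C-pos {suc n} {suc k} (s≤s k≤n) = subst (0 <_) (sym (C-pascal n k)) (ℕₚ.<-≤-trans (C-pos k≤n) (ℕₚ.m≤m+n _ _))

count-rowOnes-bitVecs : ∀ l q → count (λ c → q ≡ᵇ rowOnes c) (bitVecs l) ≡ l C q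
count-rowOnes-bitVecs zero    zero    = refl
count-rowOnes-bitVecs zero    (suc q) = refl
count-rowOnes-bitVecs (suc l) zero    = begin
  count (λ c → 0 ≡ᵇ rowOnes c) (bitVecs (suc l))
    ≡⟨ ∑-bitVecs-suc {l} (λ c → ⟦ 0 ≡ᵇ rowOnes c ⟧) ⟩
  ∑[ r ∈ bitVecs l ] 0 + count (λ c → 0 ≡ᵇ rowOnes c) (bitVecs l)
    ≡⟨ cong₂ _+_ (∑-zero (bitVecs l)) (count-rowOnes-bitVecs l 0) ⟩
  l C 0
    ≡⟨ trans (C-zeroʳ l) (sym (C-zeroʳ (suc l))) ⟩
  suc l C 0 ∎
  where open ≡-Reasoning
count-rowOnes-bitVecs (suc l) (suc q) = begin
  count (λ c → suc q ≡ᵇ rowOnes c) (bitVecs (suc l))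
    ≡⟨ ∑-bitVecs-suc {l} (λ c → ⟦ suc q ≡ᵇ rowOnes c ⟧) ⟩
  count (λ c → q ≡ᵇ rowOnes c) (bitVecs l) + count (λ c → suc q ≡ᵇ rowOnes c) (bitVecs l)
    ≡⟨ cong₂ _+_ (count-rowOnes-bitVecs l q) (count-rowOnes-bitVecs l (suc q)) ⟩
  l C q + l C suc q
    ≡⟨ C-pascal l q ⟨
  suc l C suc q ∎
  where open ≡-Reasoning

infix 5 _⊆ᵇ_
_⊆ᵇ_ : Vec Bool l → Vec Bool l → Bool
[]          ⊆ᵇ []      = true
(true ∷ r)  ⊆ᵇ (b ∷ c) = b ∧ (r ⊆ᵇ c)
(false ∷ r) ⊆ᵇ (_ ∷ c) = r ⊆ᵇ c

count-select-preimages : (c : Vec Bool l) (m : List Bool) →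
  count (λ r → (r ⊆ᵇ c) ∧ does (select c r ≟ᴸ m)) (bitVecs l) ≡ ⟦ length m ≡ᵇ rowOnes c ⟧
count-select-preimages []          []          = refl
count-select-preimages []          (_ ∷ _)     = refl
count-select-preimages {suc l} (true ∷ c) [] =
  trans (∑-bitVecs-suc {l} _) (cong₂ _+_ (count-∧-false (_⊆ᵇ c) (bitVecs l)) (count-∧-false (_⊆ᵇ c) (bitVecs l)))
count-select-preimages {suc l} (true ∷ c) (true ∷ m) =
  trans (∑-bitVecs-suc {l} _)
    (trans (cong₂ _+_ (count-select-preimages c m) (count-∧-false (_⊆ᵇ c) (bitVecs l)))
      (ℕₚ.+-identityʳ _))
count-select-preimages {suc l} (true ∷ c) (false ∷ m) =
  trans (∑-bitVecs-suc {l} _)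
    (cong₂ _+_ (count-∧-false (_⊆ᵇ c) (bitVecs l)) (count-select-preimages c m))
count-select-preimages {suc l} (false ∷ c) m =
  trans (∑-bitVecs-suc {l} _) (cong₂ _+_ (∑-zero (bitVecs l)) (count-select-preimages c m))

anyᵇ-select : (r c : Vec Bool l) → r ⊆ᵇ c ≡ true → anyᵇ r ≡ or (select c r)
anyᵇ-select []          []          _  = refl
anyᵇ-select (true ∷ r)  (true ∷ c)  _  = refl
anyᵇ-select (false ∷ r) (true ∷ c)  r⊆c = anyᵇ-select r c r⊆c
anyᵇ-select (false ∷ r) (false ∷ c) r⊆c = anyᵇ-select r c r⊆c

selectsTo : Vec Bool l → List Bool → Vec Bool l → Bool
selectsTo c m r = anyᵇ r ∧ ((r ⊆ᵇ c) ∧ does (select c r ≟ᴸ m))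

selectsTo-or : (c : Vec Bool l) (m : List Bool) (r : Vec Bool l) →
  selectsTo c m r ≡ or m ∧ ((r ⊆ᵇ c) ∧ does (select c r ≟ᴸ m))
selectsTo-or c m r with r ⊆ᵇ c in r⊆c | select c r ≟ᴸ m
... | true  | yes sel≡m = cong (_∧ true) (trans (anyᵇ-select r c r⊆c) (cong or sel≡m))
... | true  | no  _     = trans (Boolₚ.∧-zeroʳ (anyᵇ r)) (sym (Boolₚ.∧-zeroʳ (or m)))
... | false | _         = trans (Boolₚ.∧-zeroʳ (anyᵇ r)) (sym (Boolₚ.∧-zeroʳ (or m)))

preimages : Vec Bool l → List Bool → ℕ
preimages {l} c m = count (selectsTo c m) (bitVecs l)

preimages≡ : (c : Vec Bool l) (m : List Bool) → preimages c m ≡ ⟦ or m ∧ (length m ≡ᵇ rowOnes c) ⟧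
preimages≡ {l} c m = begin
  preimages c m
    ≡⟨ ∑-cong (λ r → trans (cong ⟦_⟧ (selectsTo-or c m r)) (⟦∧⟧ (or m) _)) (bitVecs l) ⟩
  ∑[ r ∈ bitVecs l ] (⟦ or m ⟧ * ⟦ (r ⊆ᵇ c) ∧ does (select c r ≟ᴸ m) ⟧)
    ≡⟨ ∑-*ˡ ⟦ or m ⟧ _ (bitVecs l) ⟩
  ⟦ or m ⟧ * count (λ r → (r ⊆ᵇ c) ∧ does (select c r ≟ᴸ m)) (bitVecs l)
    ≡⟨ cong (⟦ or m ⟧ *_) (count-select-preimages c m) ⟩
  ⟦ or m ⟧ * ⟦ length m ≡ᵇ rowOnes c ⟧
    ≡⟨ ⟦∧⟧ (or m) _ ⟨
  ⟦ or m ∧ (length m ≡ᵇ rowOnes c) ⟧ ∎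
  where open ≡-Reasoning

⊆ᵇ-∨ˡ : (r s : Vec Bool l) → r ⊆ᵇ Vec.zipWith _∨_ r s ≡ true
⊆ᵇ-∨ˡ []          []      = refl
⊆ᵇ-∨ˡ (true ∷ r)  (_ ∷ s) = ⊆ᵇ-∨ˡ r s
⊆ᵇ-∨ˡ (false ∷ r) (_ ∷ s) = ⊆ᵇ-∨ˡ r s

⊆ᵇ-∨ʳ-mono : (r t s : Vec Bool l) → r ⊆ᵇ s ≡ true → r ⊆ᵇ Vec.zipWith _∨_ t s ≡ true
⊆ᵇ-∨ʳ-mono []          []          []          _   = refl
⊆ᵇ-∨ʳ-mono (true ∷ r)  (true ∷ t)  (b ∷ s)     r⊆s = ⊆ᵇ-∨ʳ-mono r t s (proj₂ (∧≡true⇒ {b} r⊆s))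
⊆ᵇ-∨ʳ-mono (true ∷ r)  (false ∷ t) (true ∷ s)  r⊆s = ⊆ᵇ-∨ʳ-mono r t s r⊆s
⊆ᵇ-∨ʳ-mono (false ∷ r) (_ ∷ t)     (_ ∷ s)     r⊆s = ⊆ᵇ-∨ʳ-mono r t s r⊆s

∨-⊆ᵇ : (r s c : Vec Bool l) → r ⊆ᵇ c ≡ true → s ⊆ᵇ c ≡ true → Vec.zipWith _∨_ r s ⊆ᵇ c ≡ true
∨-⊆ᵇ []          []          []         _   _   = refl
∨-⊆ᵇ (true ∷ r)  (true ∷ s)  (true ∷ c) r⊆c s⊆c = ∨-⊆ᵇ r s c r⊆c s⊆c
∨-⊆ᵇ (true ∷ r)  (false ∷ s) (true ∷ c) r⊆c s⊆c = ∨-⊆ᵇ r s c r⊆c s⊆c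
∨-⊆ᵇ (false ∷ r) (true ∷ s)  (true ∷ c) r⊆c s⊆c = ∨-⊆ᵇ r s c r⊆c s⊆c
∨-⊆ᵇ (false ∷ r) (false ∷ s) (_ ∷ c)    r⊆c s⊆c = ∨-⊆ᵇ r s c r⊆c s⊆c

replicate-⊆ᵇ : (c : Vec Bool l) → Vec.replicate l false ⊆ᵇ c ≡ true
replicate-⊆ᵇ []      = refl
replicate-⊆ᵇ (_ ∷ c) = replicate-⊆ᵇ c

select-∨ : (c r s : Vec Bool l) → select c (Vec.zipWith _∨_ r s) ≡ List.zipWith _∨_ (select c r) (select c s)
select-∨ []          []      []      = refl
select-∨ (true ∷ c)  (a ∷ r) (b ∷ s) = cong ((a ∨ b) ∷_) (select-∨ c r s)
select-∨ (false ∷ c) (_ ∷ r) (_ ∷ s) = select-∨ c r s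

select-replicate : (c : Vec Bool l) → select c (Vec.replicate l false) ≡ List.replicate (rowOnes c) false
select-replicate []          = refl
select-replicate (true ∷ c)  = cong (false ∷_) (select-replicate c)
select-replicate (false ∷ c) = select-replicate c

length-select : (c r : Vec Bool l) → length (select c r) ≡ rowOnes c
length-select []          []      = refl
length-select (true ∷ c)  (_ ∷ r) = cong suc (length-select c r)
length-select (false ∷ c) (_ ∷ r) = length-select c r

zeroRow≡replicate : (r : Vec Bool l) → anyᵇ r ≡ false → r ≡ Vec.replicate l false
zeroRow≡replicate []          _   = refl
zeroRow≡replicate (false ∷ r) r≡0 = cong (false ∷_) (zeroRow≡replicate r r≡0)

zeroRow-⊆ᵇ : (r c : Vec Bool l) → anyᵇ r ≡ false → r ⊆ᵇ c ≡ true
zeroRow-⊆ᵇ r c r≡0 = subst (λ r → r ⊆ᵇ c ≡ true) (sym (zeroRow≡replicate r r≡0)) (replicate-⊆ᵇ c)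

replicate-∨ : (s : Vec Bool l) → Vec.zipWith _∨_ (Vec.replicate l false) s ≡ s
replicate-∨ []      = refl
replicate-∨ (b ∷ s) = cong (b ∷_) (replicate-∨ s)

toList-zipWith : {D : Set} (f : A → B → D) (r : Vec A l) (s : Vec B l) →
  Vec.toList (Vec.zipWith f r s) ≡ List.zipWith f (Vec.toList r) (Vec.toList s)
toList-zipWith f []      []      = refl
toList-zipWith f (a ∷ r) (b ∷ s) = cong (f a b ∷_) (toList-zipWith f r s)

allᵇ≡and : (v : Vec Bool l) → allᵇ v ≡ and (Vec.toList v)
allᵇ≡and []      = refl
allᵇ≡and (b ∷ v) = cong (b ∧_) (allᵇ≡and v)

anyᵇ≡or : (v : Vec Bool l) → anyᵇ v ≡ or (Vec.toList v)
anyᵇ≡or []      = refl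
anyᵇ≡or (b ∷ v) = cong (b ∨_) (anyᵇ≡or v)

-- Matrices reducing to M

rowsWithinᵇ : Vec Bool l → Mat k l → Bool
rowsWithinᵇ c A = allᵇ (Vec.map (_⊆ᵇ c) A)

reduceWith : Vec Bool l → Mat k l → List (List Bool)
reduceWith c A = map (select c) (filterᵇ anyᵇ (Vec.toList A))

reducesToᵇ : Vec Bool l → List (List Bool) → Mat k l → Bool
reducesToᵇ c Ms A = rowsWithinᵇ c A ∧ does (reduceWith c A ≟ᴸᴸ Ms)

⟦reducesTo⟧-[] : (c r : Vec Bool l) (A : Mat k l) →
  ⟦ reducesToᵇ c [] (r ∷ A) ⟧ ≡ ⟦ not (anyᵇ r) ⟧ * ⟦ reducesToᵇ c [] A ⟧
⟦reducesTo⟧-[] c r A with anyᵇ r in r≢0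
... | true  = cong ⟦_⟧ (Boolₚ.∧-zeroʳ _)
... | false rewrite zeroRow-⊆ᵇ r c r≢0 = sym (ℕₚ.+-identityʳ _)

⟦reducesTo⟧-∷ : (c r : Vec Bool l) (m : List Bool) (Ms : List (List Bool)) (A : Mat k l) →
  ⟦ reducesToᵇ c (m ∷ Ms) (r ∷ A) ⟧ ≡
  ⟦ not (anyᵇ r) ⟧ * ⟦ reducesToᵇ c (m ∷ Ms) A ⟧ + ⟦ selectsTo c m r ⟧ * ⟦ reducesToᵇ c Ms A ⟧
⟦reducesTo⟧-∷ c r m Ms A with anyᵇ r in r≢0
... | true  = trans (cong ⟦_⟧ (∧-interchange (r ⊆ᵇ c) (rowsWithinᵇ c A) sel≡m rest≡Ms))
                       (⟦∧⟧ ((r ⊆ᵇ c) ∧ sel≡m) (rowsWithinᵇ c A ∧ rest≡Ms))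
  where
  sel≡m rest≡Ms : Bool
  sel≡m   = does (select c r ≟ᴸ m)
  rest≡Ms = does (reduceWith c A ≟ᴸᴸ Ms)
... | false rewrite zeroRow-⊆ᵇ r c r≢0 = sym (trans (ℕₚ.+-identityʳ _) (ℕₚ.+-identityʳ _))

count-zeroRows : ∀ l → count (not ∘ anyᵇ) (bitVecs l) ≡ 1
count-zeroRows zero    = refl
count-zeroRows (suc l) = trans (∑-bitVecs-suc {l} _) (cong₂ _+_ (∑-zero (bitVecs l)) (count-zeroRows l))

reductions : Vec Bool l → ℕ → List (List Bool) → ℕ
reductions {l} c k Ms = count (reducesToᵇ c Ms) (allMats k l)

reductions-suc-[] : (c : Vec Bool l) (k : ℕ) → reductions c (suc k) [] ≡ reductions c k []
reductions-suc-[] {l} c k = begin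
  reductions c (suc k) []
    ≡⟨ ∑-vecsOver (bitVecs l) k _ ⟩
  ∑[ r ∈ bitVecs l ] ∑[ A ∈ allMats k l ] ⟦ reducesToᵇ c [] (r ∷ A) ⟧
    ≡⟨ ∑-cong (λ r → ∑-cong (⟦reducesTo⟧-[] c r) (allMats k l)) (bitVecs l) ⟩
  ∑[ r ∈ bitVecs l ] ∑[ A ∈ allMats k l ] (⟦ not (anyᵇ r) ⟧ * ⟦ reducesToᵇ c [] A ⟧)
    ≡⟨ ∑-∑-separable _ _ (bitVecs l) (allMats k l) ⟩
  count (not ∘ anyᵇ) (bitVecs l) * reductions c k []
    ≡⟨ cong (_* reductions c k []) (count-zeroRows l) ⟩
  1 * reductions c k []
    ≡⟨ ℕₚ.*-identityˡ _ ⟩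
  reductions c k [] ∎
  where open ≡-Reasoning

reductions-suc-∷ : (c : Vec Bool l) (k : ℕ) (m : List Bool) (Ms : List (List Bool)) →
  reductions c (suc k) (m ∷ Ms) ≡ reductions c k (m ∷ Ms) + preimages c m * reductions c k Ms
reductions-suc-∷ {l} c k m Ms = begin
  reductions c (suc k) (m ∷ Ms)
    ≡⟨ ∑-vecsOver (bitVecs l) k _ ⟩
  ∑[ r ∈ bitVecs l ] ∑[ A ∈ allMats k l ] ⟦ reducesToᵇ c (m ∷ Ms) (r ∷ A) ⟧
    ≡⟨ ∑-cong (λ r → ∑-cong (⟦reducesTo⟧-∷ c r m Ms) (allMats k l)) (bitVecs l) ⟩
  ∑[ r ∈ bitVecs l ] ∑[ A ∈ allMats k l ] (isZero r * R (m ∷ Ms) A + hit r * R Ms A)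
    ≡⟨ ∑-∑-separable-+ isZero hit (R (m ∷ Ms)) (R Ms) (bitVecs l) (allMats k l) ⟩
  count (not ∘ anyᵇ) (bitVecs l) * reductions c k (m ∷ Ms) + preimages c m * reductions c k Ms
    ≡⟨ cong (λ z → z * reductions c k (m ∷ Ms) + preimages c m * reductions c k Ms) (count-zeroRows l) ⟩
  1 * reductions c k (m ∷ Ms) + preimages c m * reductions c k Ms
    ≡⟨ cong (_+ preimages c m * reductions c k Ms) (ℕₚ.*-identityˡ _) ⟩
  reductions c k (m ∷ Ms) + preimages c m * reductions c k Ms ∎
  where
  open ≡-Reasoning
  isZero hit : Vec Bool l → ℕ
  isZero r = ⟦ not (anyᵇ r) ⟧
  hit    r = ⟦ selectsTo c m r ⟧
  R : List (List Bool) → Mat k l → ℕ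
  R Ns A = ⟦ reducesToᵇ c Ns A ⟧

-- A zero row of A is dropped by the reduction; a nonzero row must be sent by
-- select c onto the next row of Ms.  Choosing the rows that are nonzero gives
-- the binomial factor.
reductions≡ : (c : Vec Bool l) (k : ℕ) (Ms : List (List Bool)) →
  reductions c k Ms ≡ (k C length Ms) * product (map (preimages c) Ms)
reductions≡ c zero    []       = refl
reductions≡ c zero    (m ∷ Ms) =
  sym (cong (_* product (map (preimages c) (m ∷ Ms))) (k>n⇒nCk≡0 (s≤s (z≤n {length Ms}))))
reductions≡ c (suc k) []       = begin
  reductions c (suc k) [] ≡⟨ reductions-suc-[] c k ⟩
  reductions c k []       ≡⟨ reductions≡ c k [] ⟩
  (k C 0) * 1             ≡⟨ cong (_* 1) (trans (C-zeroʳ k) (sym (C-zeroʳ (suc k)))) ⟩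
  (suc k C 0) * 1         ∎
  where open ≡-Reasoning
reductions≡ c (suc k) (m ∷ Ms) = begin
  reductions c (suc k) (m ∷ Ms)
    ≡⟨ reductions-suc-∷ c k m Ms ⟩
  reductions c k (m ∷ Ms) + f m * reductions c k Ms
    ≡⟨ cong₂ (λ x y → x + f m * y) (reductions≡ c k (m ∷ Ms)) (reductions≡ c k Ms) ⟩
  (k C suc s) * (f m * Π) + f m * ((k C s) * Π)
    ≡⟨ solve 4 (λ a b x y → b :* (x :* y) :+ x :* (a :* y) := (a :+ b) :* (x :* y)) refl (k C s) (k C suc s) (f m) Π ⟩
  (k C s + k C suc s) * (f m * Π)
    ≡⟨ cong (_* (f m * Π)) (C-pascal k s) ⟨
  (suc k C suc s) * (f m * Π) ∎
  where
  open ≡-Reasoning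
  open ℕ-Solver.+-*-Solver
  f : List Bool → ℕ
  f = preimages c
  s : ℕ
  s = length Ms
  Π : ℕ
  Π = product (map f Ms)

rowsWithin-∨ : (t s : Vec Bool l) (A : Mat k l) → rowsWithinᵇ s A ≡ true → rowsWithinᵇ (Vec.zipWith _∨_ t s) A ≡ true
rowsWithin-∨ t s []      _         = refl
rowsWithin-∨ t s (r ∷ A) r∷A⊆s with ∧≡true⇒ r∷A⊆s
... | r⊆s , A⊆s = cong₂ _∧_ (⊆ᵇ-∨ʳ-mono r t s r⊆s) (rowsWithin-∨ t s A A⊆s)

rowsWithin-colMask : (A : Mat k l) → rowsWithinᵇ (colMask A) A ≡ true
rowsWithin-colMask []      = refl
rowsWithin-colMask (r ∷ A) = cong₂ _∧_ (⊆ᵇ-∨ˡ r (colMask A)) (rowsWithin-∨ r (colMask A) A (rowsWithin-colMask A))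

colMask-⊆ᵇ : (c : Vec Bool l) (A : Mat k l) → rowsWithinᵇ c A ≡ true → colMask A ⊆ᵇ c ≡ true
colMask-⊆ᵇ c []      _         = replicate-⊆ᵇ c
colMask-⊆ᵇ c (r ∷ A) r∷A⊆c with ∧≡true⇒ r∷A⊆c
... | r⊆c , A⊆c = ∨-⊆ᵇ r (colMask A) c r⊆c (colMask-⊆ᵇ c A A⊆c)

⊆ᵇ-select-and : (v c : Vec Bool l) → v ⊆ᵇ c ≡ true → and (select c v) ≡ true → v ≡ c
⊆ᵇ-select-and []          []          _   _     = refl
⊆ᵇ-select-and (true ∷ v)  (true ∷ c)  v⊆c all-v = cong (true ∷_) (⊆ᵇ-select-and v c v⊆c all-v)
⊆ᵇ-select-and (false ∷ v) (false ∷ c) v⊆c all-v = cong (false ∷_) (⊆ᵇ-select-and v c v⊆c all-v)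

columnsHit : ℕ → List (List Bool) → List Bool
columnsHit w = List.foldr (List.zipWith _∨_) (List.replicate w false)

select-colMask : (c : Vec Bool l) (A : Mat k l) →
  select c (colMask A) ≡ columnsHit (rowOnes c) (reduceWith c A)
select-colMask c []      = select-replicate c
select-colMask c (r ∷ A) with anyᵇ r in r≢0
... | true  = trans (select-∨ c r (colMask A)) (cong (List.zipWith _∨_ (select c r)) (select-colMask c A))
... | false = begin
  select c (Vec.zipWith _∨_ r (colMask A))
    ≡⟨ cong (λ r → select c (Vec.zipWith _∨_ r (colMask A))) (zeroRow≡replicate r r≢0) ⟩
  select c (Vec.zipWith _∨_ (Vec.replicate _ false) (colMask A))
    ≡⟨ cong (select c) (replicate-∨ (colMask A)) ⟩
  select c (colMask A)
    ≡⟨ select-colMask c A ⟩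
  columnsHit (rowOnes c) (reduceWith c A) ∎
  where open ≡-Reasoning

toList-colMask : ∀ {p q} (M : Mat p q) → Vec.toList (colMask M) ≡ columnsHit q (toLL M)
toList-colMask {q = q} []      = Vecₚ.toList-replicate q false
toList-colMask         (r ∷ M) =
  trans (toList-zipWith _∨_ r (colMask M)) (cong (List.zipWith _∨_ (Vec.toList r)) (toList-colMask M))

-- Inside c the columns hit by A are those hit by M, which are all of them.
colMask-unique : ∀ {p q} (M : Mat (suc p) q) → noZeroColᵇ M ≡ true →
  (c : Vec Bool l) (A : Mat k l) → rowsWithinᵇ c A ≡ true → reduceWith c A ≡ toLL M → colMask A ≡ c
colMask-unique {q = q} M@(r₀ ∷ _) noZeroCol c A A⊆c reduced =
  ⊆ᵇ-select-and (colMask A) c (colMask-⊆ᵇ c A A⊆c) (begin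
    and (select c (colMask A))                     ≡⟨ cong and (select-colMask c A) ⟩
    and (columnsHit (rowOnes c) (reduceWith c A))  ≡⟨ cong₂ (λ w Ms → and (columnsHit w Ms)) width reduced ⟩
    and (columnsHit q (toLL M))                    ≡⟨ cong and (toList-colMask M) ⟨
    and (Vec.toList (colMask M))                   ≡⟨ allᵇ≡and (colMask M) ⟨
    noZeroColᵇ M                                   ≡⟨ noZeroCol ⟩
    true                                           ∎)
  where
  open ≡-Reasoning
  head-width : (rs : List (Vec Bool _)) → map (select c) rs ≡ toLL M → rowOnes c ≡ q
  head-width (r ∷ _) sel≡M =
    trans (sym (length-select c r)) (trans (cong length (Listₚ.∷-injectiveˡ sel≡M)) (Vecₚ.length-toList r₀))
  width : rowOnes c ≡ q
  width = head-width (filterᵇ anyᵇ (Vec.toList A)) reduced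

reduce∧colMask≡reducesTo : ∀ {p q} (M : Mat (suc p) q) → noZeroColᵇ M ≡ true →
  (c : Vec Bool l) (A : Mat k l) →
  does (reduce A ≟ᴸᴸ toLL M) ∧ does (colMask A ≟ᵛ c) ≡ reducesToᵇ c (toLL M) A
reduce∧colMask≡reducesTo M noZeroCol c A = Boolₚ.⇔→≡ (mk⇔ to from)
  where
  to : does (reduce A ≟ᴸᴸ toLL M) ∧ does (colMask A ≟ᵛ c) ≡ true → reducesToᵇ c (toLL M) A ≡ true
  to h with ∧≡true⇒ h
  ... | reduced , mask≡c = subst (λ c → reducesToᵇ c (toLL M) A ≡ true) (does-sound (colMask A ≟ᵛ c) mask≡c)
          (cong₂ _∧_ (rowsWithin-colMask A) reduced)
  from : reducesToᵇ c (toLL M) A ≡ true → does (reduce A ≟ᴸᴸ toLL M) ∧ does (colMask A ≟ᵛ c) ≡ true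
  from h with ∧≡true⇒ h
  ... | A⊆c , reduced = cong₂ _∧_ (dec-true (reduce A ≟ᴸᴸ toLL M) (trans (cong (λ c → reduceWith c A) mask≡c) reducedWith))
                               (dec-true (colMask A ≟ᵛ c) mask≡c)
    where
    reducedWith : reduceWith c A ≡ toLL M
    reducedWith = does-sound (reduceWith c A ≟ᴸᴸ toLL M) reduced
    mask≡c : colMask A ≡ c
    mask≡c = colMask-unique M noZeroCol c A A⊆c reducedWith

ones : List Bool → ℕ
ones = count id

rowOnes-select : (r c : Vec Bool l) → r ⊆ᵇ c ≡ true → rowOnes r ≡ ones (select c r)
rowOnes-select []          []          _   = refl
rowOnes-select (true ∷ r)  (true ∷ c)  r⊆c = cong suc (rowOnes-select r c r⊆c)
rowOnes-select (false ∷ r) (true ∷ c)  r⊆c = rowOnes-select r c r⊆c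
rowOnes-select (false ∷ r) (false ∷ c) r⊆c = rowOnes-select r c r⊆c

rowOnes-zeroRow : (r : Vec Bool l) → anyᵇ r ≡ false → rowOnes r ≡ 0
rowOnes-zeroRow []          _   = refl
rowOnes-zeroRow (false ∷ r) r≡0 = rowOnes-zeroRow r r≡0

numOnes-reduceWith : (c : Vec Bool l) (A : Mat k l) → rowsWithinᵇ c A ≡ true →
  numOnes A ≡ ∑[ m ∈ reduceWith c A ] ones m
numOnes-reduceWith c []      _ = refl
numOnes-reduceWith c (r ∷ A) r∷A⊆c with ∧≡true⇒ r∷A⊆c | anyᵇ r in r≢0
... | r⊆c , A⊆c | true  = cong₂ _+_ (rowOnes-select r c r⊆c) (numOnes-reduceWith c A A⊆c)
... | r⊆c , A⊆c | false = cong₂ _+_ (rowOnes-zeroRow r r≢0) (numOnes-reduceWith c A A⊆c)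

numOnes-reduce : (A : Mat k l) → numOnes A ≡ ∑[ m ∈ reduce A ] ones m
numOnes-reduce A = numOnes-reduceWith (colMask A) A (rowsWithin-colMask A)

rowOnes≡ones : (r : Vec Bool l) → rowOnes r ≡ ones (Vec.toList r)
rowOnes≡ones []          = refl
rowOnes≡ones (true ∷ r)  = cong suc (rowOnes≡ones r)
rowOnes≡ones (false ∷ r) = rowOnes≡ones r

numOnes-toLL : (M : Mat k l) → numOnes M ≡ ∑[ m ∈ toLL M ] ones m
numOnes-toLL []      = refl
numOnes-toLL (r ∷ M) = cong₂ _+_ (rowOnes≡ones r) (numOnes-toLL M)

rowOnes≤ : (r : Vec Bool l) → rowOnes r ≤ l
rowOnes≤ []          = z≤n
rowOnes≤ (true ∷ r)  = s≤s (rowOnes≤ r)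
rowOnes≤ (false ∷ r) = ℕₚ.m≤n⇒m≤1+n (rowOnes≤ r)

numOnes≤ : (M : Mat k l) → numOnes M ≤ k * l
numOnes≤ []      = z≤n
numOnes≤ (r ∷ M) = ℕₚ.+-mono-≤ (rowOnes≤ r) (numOnes≤ M)

numOnes-condition-redundant : ∀ {p q} (M : Mat p q) (A : Mat k l) →
  (numOnes A ≡ᵇ numOnes M) ∧ eqLLᵇ (reduce A) (toLL M) ≡ does (reduce A ≟ᴸᴸ toLL M)
numOnes-condition-redundant M A rewrite eqLLᵇ≡does (reduce A) (toLL M) with reduce A ≟ᴸᴸ toLL M
... | no _         = Boolₚ.∧-zeroʳ _
... | yes reduced  = trans (Boolₚ.∧-identityʳ _) (Equivalence.to Boolₚ.T-≡ (ℕₚ.≡⇒≡ᵇ _ _ sameOnes))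
  where
  sameOnes : numOnes A ≡ numOnes M
  sameOnes = trans (numOnes-reduce A) (trans (cong (λ Ms → ∑[ m ∈ Ms ] ones m) reduced) (sym (numOnes-toLL M)))

length-toLL : ∀ {p q} (M : Mat p q) → length (toLL M) ≡ p
length-toLL M = trans (Listₚ.length-map Vec.toList (Vec.toList M)) (Vecₚ.length-toList M)

preimages-row : (c : Vec Bool l) {q : ℕ} (r : Vec Bool q) → anyᵇ r ≡ true →
  preimages c (Vec.toList r) ≡ ⟦ q ≡ᵇ rowOnes c ⟧
preimages-row c r r≢0 = trans (preimages≡ c (Vec.toList r))
  (cong₂ (λ a w → ⟦ a ∧ (w ≡ᵇ rowOnes c) ⟧) (trans (sym (anyᵇ≡or r)) r≢0) (Vecₚ.length-toList r))

product-preimages : (c : Vec Bool l) {p q : ℕ} (M : Mat (suc p) q) → noZeroRowᵇ M ≡ true →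
  product (map (preimages c) (toLL M)) ≡ ⟦ q ≡ᵇ rowOnes c ⟧
product-preimages c (r ∷ []) noZeroRow =
  trans (ℕₚ.*-identityʳ _) (preimages-row c r (proj₁ (∧≡true⇒ noZeroRow)))
product-preimages c {q = q} (r ∷ M@(_ ∷ _)) noZeroRow with ∧≡true⇒ noZeroRow
... | r≢0 , M-noZeroRow = begin
  preimages c (Vec.toList r) * product (map (preimages c) (toLL M))
    ≡⟨ cong₂ _*_ (preimages-row c r r≢0) (product-preimages c M M-noZeroRow) ⟩
  ⟦ b ⟧ * ⟦ b ⟧ ≡⟨ ⟦∧⟧ b b ⟨
  ⟦ b ∧ b ⟧     ≡⟨ cong ⟦_⟧ (Boolₚ.∧-idem b) ⟩
  ⟦ b ⟧         ∎
  where
  open ≡-Reasoning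
  b : Bool
  b = q ≡ᵇ rowOnes c

hits≡binomials : ∀ {p q} (M : Mat (suc p) q) → noZeroRowᵇ M ≡ true → noZeroColᵇ M ≡ true →
  ∀ k l → hits (numOnes M) k l M ≡ (k C suc p) * (l C q)
hits≡binomials {p} {q} M noZeroRow noZeroCol k l = begin
  hits (numOnes M) k l M
    ≡⟨ length-filterᵇ _ (allMats k l) ⟩
  count (λ A → (numOnes A ≡ᵇ numOnes M) ∧ eqLLᵇ (reduce A) (toLL M)) (allMats k l)
    ≡⟨ ∑-cong (cong ⟦_⟧ ∘ numOnes-condition-redundant M) (allMats k l) ⟩
  count (λ A → does (reduce A ≟ᴸᴸ toLL M)) (allMats k l)
    ≡⟨ count-partition _ (λ A c → does (colMask A ≟ᵛ c)) (bitVecs l) (count-≟-bitVecs ∘ colMask) (allMats k l) ⟩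
  ∑[ c ∈ bitVecs l ] count (λ A → does (reduce A ≟ᴸᴸ toLL M) ∧ does (colMask A ≟ᵛ c)) (allMats k l)
    ≡⟨ ∑-cong (λ c → ∑-cong (cong ⟦_⟧ ∘ reduce∧colMask≡reducesTo M noZeroCol c) (allMats k l)) (bitVecs l) ⟩
  ∑[ c ∈ bitVecs l ] reductions c k (toLL M)
    ≡⟨ ∑-cong (λ c → reductions≡ c k (toLL M)) (bitVecs l) ⟩
  ∑[ c ∈ bitVecs l ] ((k C length (toLL M)) * product (map (preimages c) (toLL M)))
    ≡⟨ ∑-cong (λ c → cong₂ _*_ (cong (k C_) (length-toLL M)) (product-preimages c M noZeroRow)) (bitVecs l) ⟩
  ∑[ c ∈ bitVecs l ] ((k C suc p) * ⟦ q ≡ᵇ rowOnes c ⟧)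
    ≡⟨ ∑-*ˡ (k C suc p) _ (bitVecs l) ⟩
  (k C suc p) * count (λ c → q ≡ᵇ rowOnes c) (bitVecs l)
    ≡⟨ cong ((k C suc p) *_) (count-rowOnes-bitVecs l q) ⟩
  (k C suc p) * (l C q) ∎
  where open ≡-Reasoning

-- Natural numbers as rationals

ℕtoℚ≡mkℚ : ∀ a → ℕtoℚ a ≡ mkℚ (ℤ.+ a) 0 (Coprimality.sym (Coprimality.1-coprimeTo a))
ℕtoℚ≡mkℚ a = ℚₚ.normalize-coprime (Coprimality.sym (Coprimality.1-coprimeTo a))

ℕtoℚ-suc : ∀ a → ℕtoℚ (suc a) ≡ 1ℚ ℚ.+ ℕtoℚ a
ℕtoℚ-suc a rewrite ℕtoℚ≡mkℚ a = cong (λ z → (ℤ.+ 1 ℤ.+ z) ℚ./ 1) (sym (ℤₚ.*-identityʳ (ℤ.+ a)))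

ℕtoℚ-+ : ∀ a b → ℕtoℚ (a + b) ≡ ℕtoℚ a ℚ.+ ℕtoℚ b
ℕtoℚ-+ zero    b = sym (ℚₚ.+-identityˡ (ℕtoℚ b))
ℕtoℚ-+ (suc a) b = begin
  ℕtoℚ (suc (a + b))              ≡⟨ ℕtoℚ-suc (a + b) ⟩
  1ℚ ℚ.+ ℕtoℚ (a + b)             ≡⟨ cong (1ℚ ℚ.+_) (ℕtoℚ-+ a b) ⟩
  1ℚ ℚ.+ (ℕtoℚ a ℚ.+ ℕtoℚ b)      ≡⟨ ℚₚ.+-assoc 1ℚ (ℕtoℚ a) (ℕtoℚ b) ⟨
  (1ℚ ℚ.+ ℕtoℚ a) ℚ.+ ℕtoℚ b      ≡⟨ cong (ℚ._+ ℕtoℚ b) (ℕtoℚ-suc a) ⟨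
  ℕtoℚ (suc a) ℚ.+ ℕtoℚ b         ∎
  where open ≡-Reasoning

ℕtoℚ-* : ∀ a b → ℕtoℚ (a * b) ≡ ℕtoℚ a ℚ.* ℕtoℚ b
ℕtoℚ-* zero    b = sym (ℚₚ.*-zeroˡ (ℕtoℚ b))
ℕtoℚ-* (suc a) b = begin
  ℕtoℚ (b + a * b)
    ≡⟨ ℕtoℚ-+ b (a * b) ⟩
  ℕtoℚ b ℚ.+ ℕtoℚ (a * b)
    ≡⟨ cong (ℕtoℚ b ℚ.+_) (ℕtoℚ-* a b) ⟩
  ℕtoℚ b ℚ.+ ℕtoℚ a ℚ.* ℕtoℚ b
    ≡⟨ solve 2 (λ x y → y :+ x :* y := (con 1ℚ :+ x) :* y) refl (ℕtoℚ a) (ℕtoℚ b) ⟩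
  (1ℚ ℚ.+ ℕtoℚ a) ℚ.* ℕtoℚ b
    ≡⟨ cong (ℚ._* ℕtoℚ b) (ℕtoℚ-suc a) ⟨
  ℕtoℚ (suc a) ℚ.* ℕtoℚ b ∎
  where
  open ≡-Reasoning
  open ℚ-Solver.+-*-Solver

ℕtoℚ-mono-≤ : ∀ {a b} → a ≤ b → ℕtoℚ a ℚ.≤ ℕtoℚ b
ℕtoℚ-mono-≤ {a} {b} a≤b rewrite ℕtoℚ≡mkℚ a | ℕtoℚ≡mkℚ b =
  ℚ.*≤* (subst₂ ℤ._≤_ (sym (ℤₚ.*-identityʳ (ℤ.+ a))) (sym (ℤₚ.*-identityʳ (ℤ.+ b))) (ℤ.+≤+ a≤b))

ℕtoℚ-nonNeg : ∀ a → 0ℚ ℚ.≤ ℕtoℚ a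
ℕtoℚ-nonNeg a = ℕtoℚ-mono-≤ {0} {a} z≤n

*-nonNeg : ∀ {a b} → 0ℚ ℚ.≤ a → 0ℚ ℚ.≤ b → 0ℚ ℚ.≤ a ℚ.* b
*-nonNeg {a} {b} 0≤a 0≤b = ℚₚ.nonNegative⁻¹ _
  {{ℚₚ.nonNeg*nonNeg⇒nonNeg a {{ℚ.nonNegative 0≤a}} b {{ℚ.nonNegative 0≤b}}}}

invℕ≡mkℚ : ∀ m → invℕ (suc m) ≡ mkℚ (ℤ.+ 1) m (Coprimality.1-coprimeTo (suc m))
invℕ≡mkℚ m = ℚₚ.normalize-coprime (Coprimality.1-coprimeTo (suc m))

invℕ-inverseˡ : ∀ m → invℕ (suc m) ℚ.* ℕtoℚ (suc m) ≡ 1ℚ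
invℕ-inverseˡ m rewrite invℕ≡mkℚ m | ℕtoℚ≡mkℚ (suc m) =
  ℚₚ.*-inverseˡ (mkℚ (ℤ.+ suc m) 0 (Coprimality.sym (Coprimality.1-coprimeTo (suc m))))

invℕ-nonNeg : ∀ m → 0ℚ ℚ.≤ invℕ m
invℕ-nonNeg zero    = ℚₚ.≤-refl
invℕ-nonNeg (suc m) rewrite invℕ≡mkℚ m = ℚₚ.nonNegative⁻¹ _

invℕ≤1 : ∀ m → invℕ m ℚ.≤ 1ℚ
invℕ≤1 zero    = ℚₚ.nonNegative⁻¹ 1ℚ
invℕ≤1 (suc m) rewrite invℕ≡mkℚ m = ℚ.*≤* (ℤ.+≤+ (s≤s z≤n))

archimedean : ∀ ε → 0ℚ ℚ.< ε → ∃[ m ] 1ℚ ℚ.≤ ℕtoℚ (suc m) ℚ.* ε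
archimedean ε@(mkℚ (ℤ.+ suc a) d _) _ = d , (begin
  1ℚ
    ≡⟨ trans (sym (invℕ-inverseˡ d)) (ℚₚ.*-comm (invℕ (suc d)) (ℕtoℚ (suc d))) ⟩
  ℕtoℚ (suc d) ℚ.* invℕ (suc d)
    ≤⟨ ℚₚ.*-monoˡ-≤-nonNeg (ℕtoℚ (suc d)) {{ℚ.nonNegative (ℕtoℚ-nonNeg (suc d))}} 1/d≤ε ⟩
  ℕtoℚ (suc d) ℚ.* ε ∎)
  where
  open ℚₚ.≤-Reasoning
  1/d≤ε : invℕ (suc d) ℚ.≤ ε
  1/d≤ε rewrite invℕ≡mkℚ d = ℚ.*≤* (ℤ.+≤+ (ℕₚ.*-monoˡ-≤ (suc d) (s≤s (z≤n {a}))))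
archimedean ε@(mkℚ (ℤ.+ zero)  _ _) 0<ε with () ← ℚ.positive 0<ε
archimedean ε@(mkℚ ℤ.-[1+ _ ] _ _) 0<ε with () ← ℚ.positive 0<ε

pow½-+ : ∀ a b → pow½ (a + b) ≡ pow½ a ℚ.* pow½ b
pow½-+ zero    b = sym (ℚₚ.*-identityˡ (pow½ b))
pow½-+ (suc a) b = trans (cong (½ ℚ.*_) (pow½-+ a b)) (sym (ℚₚ.*-assoc ½ (pow½ a) (pow½ b)))

pow½-nonNeg : ∀ m → 0ℚ ℚ.≤ pow½ m
pow½-nonNeg zero    = ℚₚ.nonNegative⁻¹ 1ℚ
pow½-nonNeg (suc m) = *-nonNeg (ℚₚ.nonNegative⁻¹ ½) (pow½-nonNeg m)

pow½-inverse : ∀ m → pow½ m ℚ.* ℕtoℚ (2 ^ m) ≡ 1ℚ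
pow½-inverse zero    = refl
pow½-inverse (suc m) = begin
  (½ ℚ.* pow½ m) ℚ.* ℕtoℚ (2 * 2 ^ m)
    ≡⟨ cong ((½ ℚ.* pow½ m) ℚ.*_) (ℕtoℚ-* 2 (2 ^ m)) ⟩
  (½ ℚ.* pow½ m) ℚ.* (ℕtoℚ 2 ℚ.* ℕtoℚ (2 ^ m))
    ≡⟨ solve 4 (λ a b c d → (a :* b) :* (c :* d) := (a :* c) :* (b :* d)) refl ½ (pow½ m) (ℕtoℚ 2) (ℕtoℚ (2 ^ m)) ⟩
  (½ ℚ.* ℕtoℚ 2) ℚ.* (pow½ m ℚ.* ℕtoℚ (2 ^ m))
    ≡⟨ cong (1ℚ ℚ.*_) (pow½-inverse m) ⟩
  1ℚ ∎
  where
  open ≡-Reasoning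
  open ℚ-Solver.+-*-Solver

sumℚ-++ : (xs ys : List ℚ) → sumℚ (xs ++ ys) ≡ sumℚ xs ℚ.+ sumℚ ys
sumℚ-++ []       ys = sym (ℚₚ.+-identityˡ (sumℚ ys))
sumℚ-++ (x ∷ xs) ys = trans (cong (x ℚ.+_) (sumℚ-++ xs ys)) (sym (ℚₚ.+-assoc x (sumℚ xs) (sumℚ ys)))

sumℚ-upTo-suc : (f : ℕ → ℚ) (K : ℕ) → sumℚ (map f (upTo (suc K))) ≡ sumℚ (map f (upTo K)) ℚ.+ f K
sumℚ-upTo-suc f K = begin
  sumℚ (map f (upTo (suc K)))              ≡⟨ cong (sumℚ ∘ map f) (Listₚ.upTo-∷ʳ K) ⟨
  sumℚ (map f (upTo K List.∷ʳ K))          ≡⟨ cong sumℚ (Listₚ.map-++ f (upTo K) (K ∷ [])) ⟩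
  sumℚ (map f (upTo K) ++ f K ∷ [])        ≡⟨ sumℚ-++ (map f (upTo K)) (f K ∷ []) ⟩
  sumℚ (map f (upTo K)) ℚ.+ (f K ℚ.+ 0ℚ)   ≡⟨ cong (sumℚ (map f (upTo K)) ℚ.+_) (ℚₚ.+-identityʳ (f K)) ⟩
  sumℚ (map f (upTo K)) ℚ.+ f K            ∎
  where open ≡-Reasoning

sumℚ-*ˡ : (a : ℚ) (f : A → ℚ) (xs : List A) → sumℚ (map (λ x → a ℚ.* f x) xs) ≡ a ℚ.* sumℚ (map f xs)
sumℚ-*ˡ a f []       = sym (ℚₚ.*-zeroʳ a)
sumℚ-*ˡ a f (x ∷ xs) = trans (cong (a ℚ.* f x ℚ.+_) (sumℚ-*ˡ a f xs)) (sym (ℚₚ.*-distribˡ-+ a (f x) _))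

sumℚ-*ʳ : (a : ℚ) (f : A → ℚ) (xs : List A) → sumℚ (map (λ x → f x ℚ.* a) xs) ≡ sumℚ (map f xs) ℚ.* a
sumℚ-*ʳ a f []       = sym (ℚₚ.*-zeroˡ a)
sumℚ-*ʳ a f (x ∷ xs) = trans (cong (f x ℚ.* a ℚ.+_) (sumℚ-*ʳ a f xs)) (sym (ℚₚ.*-distribʳ-+ a (f x) _))

sumℚ-separable : (f : A → ℚ) (g : B → ℚ) (s : ℚ) (xs : List A) (ys : List B) →
  sumℚ (map (λ x → sumℚ (map (λ y → (f x ℚ.* g y) ℚ.* s) ys)) xs) ≡ sumℚ (map f xs) ℚ.* (sumℚ (map g ys) ℚ.* s)
sumℚ-separable f g s xs ys = begin
  sumℚ (map (λ x → sumℚ (map (λ y → (f x ℚ.* g y) ℚ.* s) ys)) xs)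
    ≡⟨ cong sumℚ (Listₚ.map-cong (λ x → cong sumℚ (Listₚ.map-cong (λ y → ℚₚ.*-assoc (f x) (g y) s) ys)) xs) ⟩
  sumℚ (map (λ x → sumℚ (map (λ y → f x ℚ.* (g y ℚ.* s)) ys)) xs)
    ≡⟨ cong sumℚ (Listₚ.map-cong (λ x → sumℚ-*ˡ (f x) (λ y → g y ℚ.* s) ys) xs) ⟩
  sumℚ (map (λ x → f x ℚ.* sumℚ (map (λ y → g y ℚ.* s) ys)) xs)
    ≡⟨ sumℚ-*ʳ _ f xs ⟩
  sumℚ (map f xs) ℚ.* sumℚ (map (λ y → g y ℚ.* s) ys)
    ≡⟨ cong (sumℚ (map f xs) ℚ.*_) (sumℚ-*ʳ s g ys) ⟩
  sumℚ (map f xs) ℚ.* (sumℚ (map g ys) ℚ.* s) ∎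
  where open ≡-Reasoning

-- Fair coin tosses

atMostHeads : ℕ → ℕ → ℕ
atMostHeads zero    K = 1
atMostHeads (suc p) K = atMostHeads p K + K C suc p

atMostHeads-zero : ∀ p → atMostHeads p 0 ≡ 1
atMostHeads-zero zero    = refl
atMostHeads-zero (suc p) = trans (ℕₚ.+-identityʳ _) (atMostHeads-zero p)

atMostHeads-double : ∀ p K → atMostHeads p (suc K) + K C p ≡ atMostHeads p K + atMostHeads p K
atMostHeads-double zero    K = cong suc (C-zeroʳ K)
atMostHeads-double (suc p) K = begin
  atMostHeads p (suc K) + (suc K C suc p) + c
    ≡⟨ cong (λ x → atMostHeads p (suc K) + x + c) (C-pascal K p) ⟩
  atMostHeads p (suc K) + (K C p + c) + c
    ≡⟨ solve 3 (λ t b c → t :+ (b :+ c) :+ c := (t :+ b) :+ (c :+ c)) refl (atMostHeads p (suc K)) (K C p) c ⟩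
  (atMostHeads p (suc K) + K C p) + (c + c)
    ≡⟨ cong (_+ (c + c)) (atMostHeads-double p K) ⟩
  (atMostHeads p K + atMostHeads p K) + (c + c)
    ≡⟨ solve 2 (λ t c → (t :+ t) :+ (c :+ c) := (t :+ c) :+ (t :+ c)) refl (atMostHeads p K) c ⟩
  (atMostHeads p K + c) + (atMostHeads p K + c) ∎
  where
  open ≡-Reasoning
  open ℕ-Solver.+-*-Solver
  c : ℕ
  c = K C suc p

atMostHeads-suc : ∀ p K → atMostHeads (suc p) (suc K) ≡ atMostHeads (suc p) K + atMostHeads p K
atMostHeads-suc p K = ℕₚ.+-cancelʳ-≡ (K C suc p) _ _ (begin
  atMostHeads (suc p) (suc K) + K C suc p
    ≡⟨ atMostHeads-double (suc p) K ⟩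
  (atMostHeads p K + c) + (atMostHeads p K + c)
    ≡⟨ solve 2 (λ t c → (t :+ c) :+ (t :+ c) := ((t :+ c) :+ t) :+ c) refl (atMostHeads p K) c ⟩
  (atMostHeads (suc p) K + atMostHeads p K) + c ∎)
  where
  open ≡-Reasoning
  open ℕ-Solver.+-*-Solver
  c : ℕ
  c = K C suc p

atMostHeadsProb : ℕ → ℕ → ℚ
atMostHeadsProb p K = ℕtoℚ (atMostHeads p K) ℚ.* pow½ K

atMostHeadsProb-nonNeg : ∀ p K → 0ℚ ℚ.≤ atMostHeadsProb p K
atMostHeadsProb-nonNeg p K = *-nonNeg (ℕtoℚ-nonNeg (atMostHeads p K)) (pow½-nonNeg K)

-- The probability that the (p+1)-st head of a fair coin comes at toss k+1.
negBinomial : ℕ → ℕ → ℚ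
negBinomial p k = ℕtoℚ (k C p) ℚ.* pow½ (suc k)

negBinomialSum : ℕ → ℕ → ℚ
negBinomialSum p K = sumℚ (map (negBinomial p) (upTo K))

-- After K tosses either the (p+1)-st head has come or there were at most p heads.
negBinomialSum+atMostHeadsProb≡1 : ∀ p K → negBinomialSum p K ℚ.+ atMostHeadsProb p K ≡ 1ℚ
negBinomialSum+atMostHeadsProb≡1 p zero    = cong (λ t → 0ℚ ℚ.+ ℕtoℚ t ℚ.* 1ℚ) (atMostHeads-zero p)
negBinomialSum+atMostHeadsProb≡1 p (suc K) = begin
  negBinomialSum p (suc K) ℚ.+ t′ ℚ.* (½ ℚ.* w)
    ≡⟨ cong (ℚ._+ t′ ℚ.* (½ ℚ.* w)) (sumℚ-upTo-suc (negBinomial p) K) ⟩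
  (S ℚ.+ b ℚ.* (½ ℚ.* w)) ℚ.+ t′ ℚ.* (½ ℚ.* w)
    ≡⟨ solve 5 (λ S b t′ h w → (S :+ b :* (h :* w)) :+ t′ :* (h :* w) := S :+ (t′ :+ b) :* h :* w) refl S b t′ ½ w ⟩
  S ℚ.+ (t′ ℚ.+ b) ℚ.* ½ ℚ.* w
    ≡⟨ cong (λ z → S ℚ.+ z ℚ.* ½ ℚ.* w) t′+b≡t+t ⟩
  S ℚ.+ (t ℚ.+ t) ℚ.* ½ ℚ.* w
    ≡⟨ solve 4 (λ S t h w → S :+ (t :+ t) :* h :* w := S :+ t :* w :* (h :+ h)) refl S t ½ w ⟩
  S ℚ.+ t ℚ.* w ℚ.* 1ℚ
    ≡⟨ cong (S ℚ.+_) (ℚₚ.*-identityʳ (t ℚ.* w)) ⟩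
  S ℚ.+ t ℚ.* w
    ≡⟨ negBinomialSum+atMostHeadsProb≡1 p K ⟩
  1ℚ ∎
  where
  open ≡-Reasoning
  open ℚ-Solver.+-*-Solver
  S b t t′ w : ℚ
  S  = negBinomialSum p K
  b  = ℕtoℚ (K C p)
  t  = ℕtoℚ (atMostHeads p K)
  t′ = ℕtoℚ (atMostHeads p (suc K))
  w  = pow½ K
  t′+b≡t+t : t′ ℚ.+ b ≡ t ℚ.+ t
  t′+b≡t+t = begin
    t′ ℚ.+ b                                      ≡⟨ ℕtoℚ-+ (atMostHeads p (suc K)) (K C p) ⟨
    ℕtoℚ (atMostHeads p (suc K) + K C p)          ≡⟨ cong ℕtoℚ (atMostHeads-double p K) ⟩
    ℕtoℚ (atMostHeads p K + atMostHeads p K)      ≡⟨ ℕtoℚ-+ (atMostHeads p K) (atMostHeads p K) ⟩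
    t ℚ.+ t                                       ∎

negBinomialSum≡1-atMostHeadsProb : ∀ p K → negBinomialSum p K ≡ 1ℚ ℚ.- atMostHeadsProb p K
negBinomialSum≡1-atMostHeadsProb p K = begin
  negBinomialSum p K
    ≡⟨ solve 2 (λ S x → S := (S :+ x) :- x) refl (negBinomialSum p K) (atMostHeadsProb p K) ⟩
  (negBinomialSum p K ℚ.+ atMostHeadsProb p K) ℚ.- atMostHeadsProb p K
    ≡⟨ cong (ℚ._- atMostHeadsProb p K) (negBinomialSum+atMostHeadsProb≡1 p K) ⟩
  1ℚ ℚ.- atMostHeadsProb p K ∎
  where
  open ≡-Reasoning
  open ℚ-Solver.+-*-Solver

Negligible : (ℕ → ℕ) → Set
Negligible f = ∀ b → ∃[ N ] ∀ K → N ≤ K → b * f K ≤ 2 ^ K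

negligible-zero : Negligible (λ _ → 0)
negligible-zero b = 0 , λ K _ → subst (_≤ 2 ^ K) (sym (ℕₚ.*-zeroʳ b)) z≤n

n<2^n : ∀ n → n < 2 ^ n
n<2^n zero    = s≤s z≤n
n<2^n (suc n) = ℕₚ.+-mono-≤-< (ℕₚ.m^n>0 2 n) (ℕₚ.<-≤-trans (n<2^n n) (ℕₚ.m≤m+n (2 ^ n) 0))

-- Beyond N₀ the sequence u = 2b·f grows by at most 2^K per step, so
-- u K ≤ u N₀ + 2^K ≤ 2·2^K as soon as K ∸ N₀ ≥ u N₀.
negligible-step : ∀ {f g} → Negligible g → (∀ K → f (suc K) ≡ f K + g K) → Negligible f
negligible-step {f} {g} g-negligible f-suc b = u N₀ + N₀ , bound
  where
  open ℕₚ.≤-Reasoning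
  N₀ : ℕ
  N₀ = proj₁ (g-negligible (2 * b))
  u : ℕ → ℕ
  u K = 2 * b * f K
  u-suc : ∀ K → N₀ ≤ K → u (suc K) ≤ u K + 2 ^ K
  u-suc K N₀≤K = begin
    2 * b * f (suc K)      ≡⟨ cong (2 * b *_) (f-suc K) ⟩
    2 * b * (f K + g K)    ≡⟨ ℕₚ.*-distribˡ-+ (2 * b) (f K) (g K) ⟩
    u K + 2 * b * g K      ≤⟨ ℕₚ.+-monoʳ-≤ (u K) (proj₂ (g-negligible (2 * b)) K N₀≤K) ⟩
    u K + 2 ^ K            ∎
  telescope : ∀ m → u (m + N₀) + 2 ^ N₀ ≤ u N₀ + 2 ^ (m + N₀)
  telescope zero    = ℕₚ.≤-refl
  telescope (suc m) = begin
    u (suc K) + 2 ^ N₀         ≤⟨ ℕₚ.+-monoˡ-≤ (2 ^ N₀) (u-suc K (ℕₚ.m≤n+m N₀ m)) ⟩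
    u K + 2 ^ K + 2 ^ N₀       ≡⟨ ℕₚ.+-assoc (u K) (2 ^ K) (2 ^ N₀) ⟩
    u K + (2 ^ K + 2 ^ N₀)     ≡⟨ cong (u K +_) (ℕₚ.+-comm (2 ^ K) (2 ^ N₀)) ⟩
    u K + (2 ^ N₀ + 2 ^ K)     ≡⟨ ℕₚ.+-assoc (u K) (2 ^ N₀) (2 ^ K) ⟨
    u K + 2 ^ N₀ + 2 ^ K       ≤⟨ ℕₚ.+-monoˡ-≤ (2 ^ K) (telescope m) ⟩
    u N₀ + 2 ^ K + 2 ^ K       ≡⟨ ℕₚ.+-assoc (u N₀) (2 ^ K) (2 ^ K) ⟩
    u N₀ + (2 ^ K + 2 ^ K)     ≡⟨ cong (λ x → u N₀ + (2 ^ K + x)) (ℕₚ.+-identityʳ (2 ^ K)) ⟨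
    u N₀ + 2 ^ suc K           ∎
    where
    K : ℕ
    K = m + N₀
  bound : ∀ K → u N₀ + N₀ ≤ K → b * f K ≤ 2 ^ K
  bound K N≤K = ℕₚ.*-cancelˡ-≤ 2 (begin
    2 * (b * f K)                ≡⟨ ℕₚ.*-assoc 2 b (f K) ⟨
    u K                          ≡⟨ cong u m+N₀≡K ⟨
    u (m + N₀)                   ≤⟨ ℕₚ.m+n≤o⇒m≤o (u (m + N₀)) (telescope m) ⟩
    u N₀ + 2 ^ (m + N₀)          ≡⟨ cong (λ x → u N₀ + 2 ^ x) m+N₀≡K ⟩
    u N₀ + 2 ^ K                 ≤⟨ ℕₚ.+-monoˡ-≤ (2 ^ K) uN₀≤2^K ⟩
    2 ^ K + 2 ^ K                ≡⟨ cong (2 ^ K +_) (ℕₚ.+-identityʳ (2 ^ K)) ⟨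
    2 * 2 ^ K                    ∎)
    where
    m : ℕ
    m = K ∸ N₀
    m+N₀≡K : m + N₀ ≡ K
    m+N₀≡K = ℕₚ.m∸n+n≡m (ℕₚ.m+n≤o⇒m≤o N₀ (subst (_≤ K) (ℕₚ.+-comm (u N₀) N₀) N≤K))
    uN₀≤2^K : u N₀ ≤ 2 ^ K
    uN₀≤2^K = ℕₚ.≤-trans (ℕₚ.m+n≤o⇒m≤o∸n (u N₀) N≤K)
                (ℕₚ.≤-trans (ℕₚ.<⇒≤ (n<2^n m)) (ℕₚ.^-monoʳ-≤ 2 (ℕₚ.m∸n≤m K N₀)))

atMostHeads-negligible : ∀ p → Negligible (atMostHeads p)
atMostHeads-negligible zero    = negligible-step negligible-zero (λ _ → refl)
atMostHeads-negligible (suc p) = negligible-step (atMostHeads-negligible p) (atMostHeads-suc p)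

atMostHeadsProb-small : ∀ p b → ∃[ N ] ∀ K → N ≤ K → ℕtoℚ b ℚ.* atMostHeadsProb p K ℚ.≤ 1ℚ
atMostHeadsProb-small p b with atMostHeads-negligible p b
... | N , negligible = N , λ K N≤K → begin
  ℕtoℚ b ℚ.* (ℕtoℚ (atMostHeads p K) ℚ.* pow½ K)
    ≡⟨ ℚₚ.*-assoc (ℕtoℚ b) _ (pow½ K) ⟨
  (ℕtoℚ b ℚ.* ℕtoℚ (atMostHeads p K)) ℚ.* pow½ K
    ≡⟨ cong (ℚ._* pow½ K) (ℕtoℚ-* b (atMostHeads p K)) ⟨
  ℕtoℚ (b * atMostHeads p K) ℚ.* pow½ K
    ≤⟨ ℚₚ.*-monoʳ-≤-nonNeg (pow½ K) {{ℚ.nonNegative (pow½-nonNeg K)}} (ℕtoℚ-mono-≤ (negligible K N≤K)) ⟩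
  ℕtoℚ (2 ^ K) ℚ.* pow½ K
    ≡⟨ trans (ℚₚ.*-comm (ℕtoℚ (2 ^ K)) (pow½ K)) (pow½-inverse K) ⟩
  1ℚ ∎
  where open ℚₚ.≤-Reasoning

-- The series

C*C-vanishes : ∀ {n p q} k l → n ≤ p * q → (k * l) C n ≡ 0 → (k C p) * (l C q) ≡ 0
C*C-vanishes {n} {p} {q} k l n≤pq klCn≡0 with p ℕₚ.≤? k | q ℕₚ.≤? l
... | yes p≤k | yes q≤l = ⊥-elim (ℕₚ.<⇒≢ (C-pos (ℕₚ.≤-trans n≤pq (ℕₚ.*-mono-≤ p≤k q≤l))) (sym klCn≡0))
... | no  p≰k | _       = cong (_* (l C q)) (k>n⇒nCk≡0 (ℕₚ.≰⇒> p≰k))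
... | yes _   | no  q≰l = trans (cong ((k C p) *_) (k>n⇒nCk≡0 (ℕₚ.≰⇒> q≰l))) (ℕₚ.*-zeroʳ (k C p))

-- The hypothesis covers the junk value invℕ 0 = 0ℚ.
invℕ-cancel : ∀ a (w s h : ℚ) → (a ≡ 0 → h ≡ 0ℚ) →
  ((ℕtoℚ a ℚ.* w) ℚ.* s ℚ.* h) ℚ.* invℕ a ≡ (w ℚ.* s) ℚ.* h
invℕ-cancel zero    w s h h≡0 rewrite h≡0 refl =
  trans (ℚₚ.*-zeroʳ ((ℕtoℚ 0 ℚ.* w) ℚ.* s ℚ.* 0ℚ)) (sym (ℚₚ.*-zeroʳ (w ℚ.* s)))
invℕ-cancel (suc c) w s h _   = begin
  ((ℕtoℚ (suc c) ℚ.* w) ℚ.* s ℚ.* h) ℚ.* invℕ (suc c)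
    ≡⟨ solve 5 (λ a w s h i → ((a :* w) :* s :* h) :* i := (i :* a) :* (w :* s :* h))
               refl (ℕtoℚ (suc c)) w s h (invℕ (suc c)) ⟩
  (invℕ (suc c) ℚ.* ℕtoℚ (suc c)) ℚ.* (w ℚ.* s ℚ.* h)
    ≡⟨ cong (ℚ._* (w ℚ.* s ℚ.* h)) (invℕ-inverseˡ c) ⟩
  1ℚ ℚ.* (w ℚ.* s ℚ.* h)
    ≡⟨ ℚₚ.*-identityˡ _ ⟩
  w ℚ.* s ℚ.* h ∎
  where
  open ≡-Reasoning
  open ℚ-Solver.+-*-Solver

term≡ : ∀ n k l {p q} (M : Mat p q) → ((k * l) C n ≡ 0 → hits n k l M ≡ 0) →
  term n k l M ≡ (pow½ (k + l + 2) ℚ.* invℕ (F1111 n)) ℚ.* ℕtoℚ (hits n k l M)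
term≡ n k l M vanish =
  invℕ-cancel ((k * l) C n) (pow½ (k + l + 2)) (invℕ (F1111 n)) (ℕtoℚ (hits n k l M)) (cong ℕtoℚ ∘ vanish)

term≡negBinomial : ∀ {p q} (M : Mat p q) → (∀ k l → hits (numOnes M) k l M ≡ (k C p) * (l C q)) →
  ∀ k l → term (numOnes M) k l M ≡ (negBinomial p k ℚ.* negBinomial q l) ℚ.* invℕ (F1111 (numOnes M))
term≡negBinomial {p} {q} M hits≡C*C k l = begin
  term (numOnes M) k l M
    ≡⟨ term≡ (numOnes M) k l M (λ klCn≡0 → trans (hits≡C*C k l) (C*C-vanishes {p = p} {q = q} k l (numOnes≤ M) klCn≡0)) ⟩
  (pow½ (k + l + 2) ℚ.* s) ℚ.* ℕtoℚ (hits (numOnes M) k l M)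
    ≡⟨ cong₂ (λ w h → (w ℚ.* s) ℚ.* ℕtoℚ h) (trans (cong pow½ k+l+2≡) (pow½-+ (suc k) (suc l))) (hits≡C*C k l) ⟩
  (pow½ (suc k) ℚ.* pow½ (suc l) ℚ.* s) ℚ.* ℕtoℚ ((k C p) * (l C q))
    ≡⟨ cong (pow½ (suc k) ℚ.* pow½ (suc l) ℚ.* s ℚ.*_) (ℕtoℚ-* (k C p) (l C q)) ⟩
  (pow½ (suc k) ℚ.* pow½ (suc l) ℚ.* s) ℚ.* (ℕtoℚ (k C p) ℚ.* ℕtoℚ (l C q))
    ≡⟨ solve 5 (λ a b s x y → (a :* b :* s) :* (x :* y) := (x :* a) :* (y :* b) :* s)
               refl (pow½ (suc k)) (pow½ (suc l)) s (ℕtoℚ (k C p)) (ℕtoℚ (l C q)) ⟩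
  (negBinomial p k ℚ.* negBinomial q l) ℚ.* s ∎
  where
  open ≡-Reasoning
  open ℚ-Solver.+-*-Solver
  s : ℚ
  s = invℕ (F1111 (numOnes M))
  k+l+2≡ : k + l + 2 ≡ suc k + suc l
  k+l+2≡ = trans (ℕₚ.+-assoc k l 2) (trans (cong (k +_) (ℕₚ.+-comm l 2)) (ℕₚ.+-suc k (suc l)))

partialProb≡ : ∀ {p q} (M : Mat p q) → (∀ k l → hits (numOnes M) k l M ≡ (k C p) * (l C q)) →
  ∀ K L → partialProb (numOnes M) K L M ≡ negBinomialSum p K ℚ.* (negBinomialSum q L ℚ.* invℕ (F1111 (numOnes M)))
partialProb≡ {p} {q} M hits≡C*C K L =
  trans (cong sumℚ (Listₚ.map-cong (λ k → cong sumℚ (Listₚ.map-cong (term≡negBinomial M hits≡C*C k) (upTo L))) (upTo K)))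
        (sumℚ-separable (negBinomial p) (negBinomial q) _ (upTo K) (upTo L))

*-≤-of-≤1 : ∀ {a b} → 0ℚ ℚ.≤ b → a ℚ.≤ 1ℚ → a ℚ.* b ℚ.≤ b
*-≤-of-≤1 {a} {b} 0≤b a≤1 =
  ℚₚ.≤-trans (ℚₚ.*-monoʳ-≤-nonNeg b {{ℚ.nonNegative 0≤b}} a≤1) (ℚₚ.≤-reflexive (ℚₚ.*-identityˡ b))

≤1-of-*≤1 : ∀ {c x} → 1ℚ ℚ.≤ c → 0ℚ ℚ.≤ x → c ℚ.* x ℚ.≤ 1ℚ → x ℚ.≤ 1ℚ
≤1-of-*≤1 {c} {x} 1≤c 0≤x cx≤1 =
  ℚₚ.≤-trans (ℚₚ.≤-reflexive (sym (ℚₚ.*-identityˡ x)))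
    (ℚₚ.≤-trans (ℚₚ.*-monoʳ-≤-nonNeg x {{ℚ.nonNegative 0≤x}} 1≤c) cx≤1)

product-error : ∀ {s x y} → 0ℚ ℚ.≤ s → s ℚ.≤ 1ℚ → 0ℚ ℚ.≤ x → x ℚ.≤ 1ℚ → 0ℚ ℚ.≤ y →
  ℚ.∣ (1ℚ ℚ.- x) ℚ.* ((1ℚ ℚ.- y) ℚ.* s) ℚ.- s ∣ ℚ.≤ x ℚ.+ y
product-error {s} {x} {y} 0≤s s≤1 0≤x x≤1 0≤y = begin
  ℚ.∣ (1ℚ ℚ.- x) ℚ.* ((1ℚ ℚ.- y) ℚ.* s) ℚ.- s ∣
    ≡⟨ cong ℚ.∣_∣ (solve 3 (λ s x y → (con 1ℚ :- x) :* ((con 1ℚ :- y) :* s) :- s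
                                       := :- (s :* x :+ (s :* (con 1ℚ :- x)) :* y)) refl s x y) ⟩
  ℚ.∣ ℚ.- e ∣
    ≡⟨ ℚₚ.∣-p∣≡∣p∣ e ⟩
  ℚ.∣ e ∣
    ≡⟨ ℚₚ.0≤p⇒∣p∣≡p (ℚₚ.+-mono-≤ (*-nonNeg 0≤s 0≤x) (*-nonNeg (*-nonNeg 0≤s 0≤1-x) 0≤y)) ⟩
  e
    ≤⟨ ℚₚ.+-mono-≤ (*-≤-of-≤1 0≤x s≤1) (*-≤-of-≤1 0≤y (ℚₚ.≤-trans (*-≤-of-≤1 0≤1-x s≤1) 1-x≤1)) ⟩
  x ℚ.+ y ∎
  where
  open ℚₚ.≤-Reasoning
  open ℚ-Solver.+-*-Solver
  e : ℚ
  e = s ℚ.* x ℚ.+ (s ℚ.* (1ℚ ℚ.- x)) ℚ.* y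
  0≤1-x : 0ℚ ℚ.≤ 1ℚ ℚ.- x
  0≤1-x = ℚₚ.≤-trans (ℚₚ.≤-reflexive (sym (ℚₚ.+-inverseʳ x))) (ℚₚ.+-monoˡ-≤ (ℚ.- x) x≤1)
  1-x≤1 : 1ℚ ℚ.- x ℚ.≤ 1ℚ
  1-x≤1 = ℚₚ.+-monoʳ-≤ 1ℚ (ℚₚ.neg-antimono-≤ 0≤x)

sum<ε : ∀ {ε x y} m → 1ℚ ℚ.≤ ℕtoℚ (suc m) ℚ.* ε →
  ℕtoℚ (3 * suc m) ℚ.* x ℚ.≤ 1ℚ → ℕtoℚ (3 * suc m) ℚ.* y ℚ.≤ 1ℚ → x ℚ.+ y ℚ.< ε
sum<ε {ε} {x} {y} m 1≤mε cx≤1 cy≤1 = ℚₚ.*-cancelˡ-<-nonNeg c {{ℚ.nonNegative (ℕtoℚ-nonNeg (3 * suc m))}} (begin-strict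
  c ℚ.* (x ℚ.+ y)                    ≡⟨ ℚₚ.*-distribˡ-+ c x y ⟩
  c ℚ.* x ℚ.+ c ℚ.* y                ≤⟨ ℚₚ.+-mono-≤ cx≤1 cy≤1 ⟩
  1ℚ ℚ.+ 1ℚ                          <⟨ ℚ.*<* (ℤ.+<+ ℕₚ.≤-refl) ⟩
  ℕtoℚ 3 ℚ.* 1ℚ                      ≤⟨ ℚₚ.*-monoˡ-≤-nonNeg (ℕtoℚ 3) 1≤mε ⟩
  ℕtoℚ 3 ℚ.* (ℕtoℚ (suc m) ℚ.* ε)    ≡⟨ ℚₚ.*-assoc (ℕtoℚ 3) (ℕtoℚ (suc m)) ε ⟨
  (ℕtoℚ 3 ℚ.* ℕtoℚ (suc m)) ℚ.* ε    ≡⟨ cong (ℚ._* ε) (ℕtoℚ-* 3 (suc m)) ⟨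
  c ℚ.* ε                            ∎)
  where
  open ℚₚ.≤-Reasoning
  c : ℚ
  c = ℕtoℚ (3 * suc m)

probIs-of-factorisation : ∀ n {p q} (M : Mat p q) (s : ℚ) → 0ℚ ℚ.≤ s → s ℚ.≤ 1ℚ →
  (∀ K L → partialProb n K L M ≡ negBinomialSum p K ℚ.* (negBinomialSum q L ℚ.* s)) → ProbIs n M s
probIs-of-factorisation n {p} {q} M s 0≤s s≤1 partial≡ ε 0<ε = Nₚ + N_q , close
  where
  m : ℕ
  m = proj₁ (archimedean ε 0<ε)
  b : ℕ
  b = 3 * suc m
  Nₚ N_q : ℕ
  Nₚ  = proj₁ (atMostHeadsProb-small p b)
  N_q = proj₁ (atMostHeadsProb-small q b)
  close : ∀ K L → Nₚ + N_q ≤ K → Nₚ + N_q ≤ L → ℚ.∣ partialProb n K L M ℚ.- s ∣ ℚ.< ε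
  close K L N≤K N≤L = begin-strict
    ℚ.∣ partialProb n K L M ℚ.- s ∣
      ≡⟨ cong (λ z → ℚ.∣ z ℚ.- s ∣) (trans (partial≡ K L)
           (cong₂ (λ a b → a ℚ.* (b ℚ.* s))
             (negBinomialSum≡1-atMostHeadsProb p K) (negBinomialSum≡1-atMostHeadsProb q L))) ⟩
    ℚ.∣ (1ℚ ℚ.- x) ℚ.* ((1ℚ ℚ.- y) ℚ.* s) ℚ.- s ∣
      ≤⟨ product-error 0≤s s≤1 0≤x (≤1-of-*≤1 1≤b 0≤x bx≤1) (atMostHeadsProb-nonNeg q L) ⟩
    x ℚ.+ y
      <⟨ sum<ε m (proj₂ (archimedean ε 0<ε)) bx≤1 by≤1 ⟩
    ε ∎
    where
    open ℚₚ.≤-Reasoning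
    x y : ℚ
    x = atMostHeadsProb p K
    y = atMostHeadsProb q L
    0≤x : 0ℚ ℚ.≤ x
    0≤x = atMostHeadsProb-nonNeg p K
    1≤b : 1ℚ ℚ.≤ ℕtoℚ b
    1≤b = ℕtoℚ-mono-≤ {1} {b} (s≤s z≤n)
    bx≤1 : ℕtoℚ b ℚ.* x ℚ.≤ 1ℚ
    bx≤1 = proj₂ (atMostHeadsProb-small p b) K (ℕₚ.m+n≤o⇒m≤o Nₚ N≤K)
    by≤1 : ℕtoℚ b ℚ.* y ℚ.≤ 1ℚ
    by≤1 = proj₂ (atMostHeadsProb-small q b) L (ℕₚ.m+n≤o⇒m≤o N_q (subst (_≤ L) (ℕₚ.+-comm Nₚ N_q) N≤L))

theorem3 : (n : ℕ) → 1 ≤ n → (p q : ℕ) (M : Mat p q) →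
    numOnes M ≡ n → noZeroRowᵇ M ≡ true → noZeroColᵇ M ≡ true →
    ProbIs n M (invℕ (F1111 n))
theorem3 _ () zero    q []    refl _         _
theorem3 _ _  (suc p) q M     refl noZeroRow noZeroCol =
  probIs-of-factorisation (numOnes M) M (invℕ F) (invℕ-nonNeg F) (invℕ≤1 F)
    (partialProb≡ M (hits≡binomials M noZeroRow noZeroCol))
  where
  F : ℕ
  F = F1111 (numOnes M)
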